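{- For every positive integer $k$, there exist infinitely many finite graphs $G_n=(V_n,E_n)$ such that, for each $n$: (1) $\chi_D(G_n)>\chi(G_n)>k$; (2) $G_n$ is vertex-transitive and $|\mathrm{Aut}(G_n)|<2k|V_n|$.
   Context: $\chi(G)$ is the chromatic number of $G$ and $\mathrm{Aut}(G)$ its full automorphism group. The distinguishing chromatic number $\chi_D(G)$ is the least integer $r$ such that $V(G)$ can be partitioned into independent sets $V_1,\dots,V_r$ with the property that for every non-identity automorphism $\varphi$ of $G$ there is some $i$ with $\varphi(V_i)\neq V_i$ (i.e. a proper coloring that no non-trivial automorphism preserves class-wise). -}

module Defs where

open import Data.Nat using (ℕ; _<_)
open import Data.Fin using (Fin)
open import Data.Bool using (Bool)
open import Data.List using (List; length)
open import Data.List.Membership.Propositional using (_∈_)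
open import Data.List.Relation.Unary.Any using (Any)
open import Data.List.Relation.Unary.AllPairs using (AllPairs)
open import Data.Product using (Σ; ∃; _×_; proj₁)
open import Relation.Binary.PropositionalEquality using (_≡_; _≢_)
open import Relation.Nullary using (¬_)
open import Function.Bundles using (_↔_; Inverse)

record Graph : Set where
  field
    size   : ℕ
    adj    : Fin size → Fin size → Bool
    symm   : ∀ u v → adj u v ≡ adj v u
    irrefl : ∀ v → adj v v ≡ Bool.false

open Graph public

V : Graph → Set
V G = Fin (size G)

IsAutomorphism : (G : Graph) → (V G ↔ V G) → Set
IsAutomorphism G σ = ∀ u v → adj G (Inverse.to σ u) (Inverse.to σ v) ≡ adj G u v

Aut : Graph → Set
Aut G = Σ (V G ↔ V G) (IsAutomorphism G)

app : (G : Graph) → Aut G → V G → V G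
app G φ = Inverse.to (proj₁ φ)

SameAut : (G : Graph) → Aut G → Aut G → Set
SameAut G φ ψ = ∀ v → app G φ v ≡ app G ψ v

AutOrder : Graph → ℕ → Set
AutOrder G N = Σ (List (Aut G)) λ L →
  (∀ φ → Any (λ ψ → SameAut G φ ψ) L) × AllPairs (λ φ ψ → ¬ (SameAut G φ ψ)) L × length L ≡ N

VertexTransitive : Graph → Set
VertexTransitive G = ∀ u v → Σ (Aut G) λ φ → app G φ u ≡ v

IsProperColoring : (G : Graph) (r : ℕ) → (V G → Fin r) → Set
IsProperColoring G r f = ∀ u v → adj G u v ≡ Bool.true → f u ≢ f v

Colorable : Graph → ℕ → Set
Colorable G r = Σ (V G → Fin r) (IsProperColoring G r)

-- φ(V_i) = V_i for every colour class i.
PreservesClasses : (G : Graph) (r : ℕ) → (V G → Fin r) → Aut G → Set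
PreservesClasses G r f φ = ∀ i (v : V G) → (f v ≡ i → f (app G φ v) ≡ i) × (f (app G φ v) ≡ i → f v ≡ i)

IsIdentity : (G : Graph) → Aut G → Set
IsIdentity G φ = ∀ v → app G φ v ≡ v

DistColorable : Graph → ℕ → Set
DistColorable G r = Σ (V G → Fin r) λ f →
  IsProperColoring G r f × (∀ φ → ¬ IsIdentity G φ → ¬ PreservesClasses G r f φ)

IsChromaticNumber : Graph → ℕ → Set
IsChromaticNumber G c = Colorable G c × (∀ r → r < c → ¬ Colorable G r)

IsDistChromaticNumber : Graph → ℕ → Set
IsDistChromaticNumber G d = DistColorable G d × (∀ r → r < d → ¬ DistColorable G r)

module Submission where

open import Level using (0ℓ)
open import Data.Nat using (ℕ; zero; suc; _+_; _*_; _∸_; _<_; _≤_; _≤?_; z≤n; s≤s; s≤s⁻¹; z<s; NonZero; >-nonZero⁻¹)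
open import Data.Nat.Properties hiding (_≟_)
open import Data.Nat.DivMod using (_%_; m%n<n; m<n⇒m%n≡m; %-distribˡ-+; n%n≡0; m∣n⇒o%n%m≡o%m; m*n%n≡0)
open import Data.Nat.Divisibility using (m∣m*n)
open import Data.Fin using (Fin; toℕ; fromℕ<; fromℕ; inject₁; join; splitAt; _≟_)
import Data.Fin as Fin
open import Data.Fin.Properties using (toℕ-fromℕ<; toℕ-injective; toℕ<n; join-splitAt; splitAt-join; pigeonhole; fromℕ≢inject₁; inject₁-injective)
open import Data.Bool using (Bool; true; false)
open import Data.Bool.Properties using (∨-comm; ¬-not)
open import Data.Sum using (_⊎_; inj₁; inj₂; swap)
import Data.Sum
open import Data.Sum.Properties using (inj₁-injective)
open import Data.Product using (Σ; _×_; _,_; proj₁; proj₂; uncurry)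
open import Data.Empty using (⊥; ⊥-elim)
open import Data.List using (List; allFin; map; length)
open import Data.List.Properties using (length-map; length-tabulate)
open import Data.List.Membership.Propositional.Properties using (∈-allFin)
open import Data.List.Relation.Unary.Unique.Propositional.Properties using (allFin⁺)
import Data.List.Relation.Unary.Any as Any
import Data.List.Relation.Unary.Any.Properties as Any
import Data.List.Relation.Unary.AllPairs as AllPairs
import Data.List.Relation.Unary.AllPairs.Properties as AllPairs
open import Function.Bundles using (Inverse; mk↔ₛ′)
open import Relation.Nullary using (¬_; Dec; yes; no; does)
open import Relation.Nullary.Decidable using (_×-dec_; _⊎-dec_; dec-true; dec-false)
open import Relation.Binary.PropositionalEquality hiding ([_])
open import Algebra.Bundles using (AbelianGroup)
open import Algebra.Structures using (IsAbelianGroup)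
import Algebra.Properties.AbelianGroup as AbelianGroupProperties
open import Defs

-- Theorem 1.1.  For k ≥ 1 take c = k + 2, N = c (8 + m) and let G be the
-- Cayley graph of the dihedral group D_N whose connection set consists of
-- the rotations by ±1, …, ±(c - 1) and the reflections by 0, c and 3c.
--  * Left translations are automorphisms, so G is vertex-transitive; if only
--    the identity fixes the unit e, then |Aut G| = |D_N| = |V(G)| (generic
--    dihedral Cayley graphs, DihedralCayley).
--  * Rigidity: an edge uv is special when the neighbours of u outside N(v)
--    are independent; exactly the edges to rot (±1) are special.  So an
--    automorphism fixing e acts on each coset of rotations by x ↦ ±x plus a
--    shift, and the asymmetric reflection set {0, c, 3c} leaves only the
--    identity (Construction, Rigidity).
--  * χ(G) = c: rot 0, …, rot (c - 1) form a clique and residues mod c colour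
--    G properly.  Every proper c-colouring is invariant under the rotation
--    by c, and a fresh colour for e is distinguishing, so χ_D(G) = c + 1
--    (general colouring lemmas, Colouring).

module Cyclic (N : ℕ) .{{_ : NonZero N}} where
  open ≡-Reasoning

  0<N : 0 < N
  0<N = >-nonZero⁻¹ N

  [_] : ℕ → Fin N
  [ n ] = fromℕ< (m%n<n n N)

  toℕ-[] : ∀ n → toℕ [ n ] ≡ n % N
  toℕ-[] n = toℕ-fromℕ< (m%n<n n N)

  toℕ-[]-small : ∀ {n} → n < N → toℕ [ n ] ≡ n
  toℕ-[]-small n<N = trans (toℕ-[] _) (m<n⇒m%n≡m n<N)

  []-toℕ : ∀ x → [ toℕ x ] ≡ x
  []-toℕ x = toℕ-injective (toℕ-[]-small (toℕ<n x))

  infixl 6 _⊕_ _⊝_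
  infix  8 ⊖_

  𝟘 : Fin N
  𝟘 = [ 0 ]

  toℕ-𝟘 : toℕ 𝟘 ≡ 0
  toℕ-𝟘 = toℕ-[]-small 0<N

  _⊕_ : Fin N → Fin N → Fin N
  x ⊕ y = [ toℕ x + toℕ y ]

  ⊖_ : Fin N → Fin N
  ⊖ x = [ N ∸ toℕ x ]

  _⊝_ : Fin N → Fin N → Fin N
  x ⊝ y = x ⊕ ⊖ y

  -- Reduction modulo N is additive; every group law is a consequence.
  []-+ : ∀ a b → [ a + b ] ≡ [ a ] ⊕ [ b ]
  []-+ a b = toℕ-injective (begin
    toℕ [ a + b ]                     ≡⟨ toℕ-[] (a + b) ⟩
    (a + b) % N                       ≡⟨ %-distribˡ-+ a b N ⟩
    (a % N + b % N) % N               ≡⟨ cong₂ (λ u v → (u + v) % N) (toℕ-[] a) (toℕ-[] b) ⟨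
    (toℕ [ a ] + toℕ [ b ]) % N       ≡⟨ toℕ-[] _ ⟨
    toℕ ([ a ] ⊕ [ b ])               ∎)

  ⊕-assoc : ∀ x y z → (x ⊕ y) ⊕ z ≡ x ⊕ (y ⊕ z)
  ⊕-assoc x y z = begin
    (x ⊕ y) ⊕ z                       ≡⟨⟩
    [ toℕ x + toℕ y ] ⊕ z            ≡⟨ cong ([ toℕ x + toℕ y ] ⊕_) ([]-toℕ z) ⟨
    [ toℕ x + toℕ y ] ⊕ [ toℕ z ]    ≡⟨ []-+ (toℕ x + toℕ y) (toℕ z) ⟨
    [ toℕ x + toℕ y + toℕ z ]         ≡⟨ cong [_] (+-assoc (toℕ x) (toℕ y) (toℕ z)) ⟩
    [ toℕ x + (toℕ y + toℕ z) ]       ≡⟨ []-+ (toℕ x) (toℕ y + toℕ z) ⟩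
    [ toℕ x ] ⊕ [ toℕ y + toℕ z ]    ≡⟨ cong (_⊕ (y ⊕ z)) ([]-toℕ x) ⟩
    x ⊕ (y ⊕ z)                       ∎

  ⊕-comm : ∀ x y → x ⊕ y ≡ y ⊕ x
  ⊕-comm x y = cong [_] (+-comm (toℕ x) (toℕ y))

  ⊕-identityˡ : ∀ x → 𝟘 ⊕ x ≡ x
  ⊕-identityˡ x = trans (cong (λ n → [ n + toℕ x ]) toℕ-𝟘) ([]-toℕ x)

  ⊕-inverseʳ : ∀ x → x ⊕ ⊖ x ≡ 𝟘
  ⊕-inverseʳ x = begin
    x ⊕ ⊖ x                           ≡⟨ cong (λ y → y ⊕ ⊖ x) ([]-toℕ x) ⟨
    [ toℕ x ] ⊕ [ N ∸ toℕ x ]        ≡⟨ []-+ (toℕ x) (N ∸ toℕ x) ⟨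
    [ toℕ x + (N ∸ toℕ x) ]          ≡⟨ cong [_] (m+[n∸m]≡n (<⇒≤ (toℕ<n x))) ⟩
    [ N ]                             ≡⟨ toℕ-injective (trans (toℕ-[] N) (trans (n%n≡0 N) (sym toℕ-𝟘))) ⟩
    𝟘                                 ∎

  isAbelianGroup : IsAbelianGroup _≡_ _⊕_ 𝟘 ⊖_
  isAbelianGroup = record
    { isGroup = record
      { isMonoid = record
        { isSemigroup = record
          { isMagma = record { isEquivalence = isEquivalence ; ∙-cong = cong₂ _⊕_ }
          ; assoc   = ⊕-assoc
          }
        ; identity = ⊕-identityˡ , λ x → trans (⊕-comm x 𝟘) (⊕-identityˡ x)
        }
      ; inverse = (λ x → trans (⊕-comm (⊖ x) x) (⊕-inverseʳ x)) , ⊕-inverseʳ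
      ; ⁻¹-cong = cong ⊖_
      }
    ; comm = ⊕-comm
    }

  abelianGroup : AbelianGroup 0ℓ 0ℓ
  abelianGroup = record { isAbelianGroup = isAbelianGroup }

  open AbelianGroupProperties abelianGroup public
  open IsAbelianGroup isAbelianGroup public using (identityˡ; identityʳ; inverseˡ; inverseʳ)
  open import Algebra.Properties.CommutativeSemigroup (AbelianGroup.commutativeSemigroup abelianGroup) public
    using (interchange; x∙yz≈y∙xz)

  ⊝-identityʳ : ∀ a → a ⊝ 𝟘 ≡ a
  ⊝-identityʳ a = trans (cong (a ⊕_) ε⁻¹≈ε) (identityʳ a)

  ⊕-⊝-cancelˡ : ∀ g a b → (g ⊕ a) ⊝ (g ⊕ b) ≡ a ⊝ b
  ⊕-⊝-cancelˡ g a b = begin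
    (g ⊕ a) ⊕ ⊖ (g ⊕ b)      ≡⟨ cong ((g ⊕ a) ⊕_) (⁻¹-∙-comm g b) ⟨
    (g ⊕ a) ⊕ (⊖ g ⊕ ⊖ b)    ≡⟨ interchange g a (⊖ g) (⊖ b) ⟩
    (g ⊕ ⊖ g) ⊕ (a ⊕ ⊖ b)    ≡⟨ cong (_⊕ (a ⊝ b)) (inverseʳ g) ⟩
    𝟘 ⊕ (a ⊝ b)              ≡⟨ identityˡ (a ⊝ b) ⟩
    a ⊝ b                     ∎

  ⊝-⊝-cancelˡ : ∀ g a b → (g ⊝ a) ⊝ (g ⊝ b) ≡ b ⊝ a
  ⊝-⊝-cancelˡ g a b = begin
    (g ⊝ a) ⊝ (g ⊝ b)        ≡⟨ ⊕-⊝-cancelˡ g (⊖ a) (⊖ b) ⟩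
    ⊖ a ⊕ ⊖ ⊖ b              ≡⟨ cong (⊖ a ⊕_) (⁻¹-involutive b) ⟩
    ⊖ a ⊕ b                   ≡⟨ ⊕-comm (⊖ a) b ⟩
    b ⊝ a                     ∎

  ⊝-involutive : ∀ g a → g ⊝ (g ⊝ a) ≡ a
  ⊝-involutive g a = begin
    g ⊕ ⊖ (g ⊝ a)            ≡⟨ cong (g ⊕_) (⁻¹-anti-homo‿- g a) ⟩
    g ⊕ (a ⊕ ⊖ g)            ≡⟨ x∙yz≈y∙xz g a (⊖ g) ⟩
    a ⊕ (g ⊕ ⊖ g)            ≡⟨ cong (a ⊕_) (inverseʳ g) ⟩
    a ⊕ 𝟘                     ≡⟨ identityʳ a ⟩
    a                         ∎

  []-injective : ∀ {a b} → a < N → b < N → [ a ] ≡ [ b ] → a ≡ b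
  []-injective a<N b<N eq = trans (sym (toℕ-[]-small a<N)) (trans (cong toℕ eq) (toℕ-[]-small b<N))

  []≢⊖[] : ∀ {a b} → 0 < a + b → a + b < N → [ a ] ≢ ⊖ [ b ]
  []≢⊖[] {a} {b} 0<a+b a+b<N eq = <⇒≢ 0<a+b (sym ([]-injective a+b<N 0<N (begin
    [ a + b ]          ≡⟨ []-+ a b ⟩
    [ a ] ⊕ [ b ]      ≡⟨ cong (_⊕ [ b ]) eq ⟩
    ⊖ [ b ] ⊕ [ b ]    ≡⟨ inverseˡ [ b ] ⟩
    𝟘                  ∎)))

  toℕ-⊖[] : ∀ {t} → 0 < t → t < N → toℕ (⊖ [ t ]) ≡ N ∸ t
  toℕ-⊖[] {t} 0<t t<N = trans (cong (λ n → toℕ [ N ∸ n ]) (toℕ-[]-small t<N))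
                              (toℕ-[]-small (∸-monoʳ-< 0<t (<⇒≤ t<N)))

  [+]⊝[] : ∀ a b → [ a + b ] ⊝ [ a ] ≡ [ b ]
  [+]⊝[] a b = begin
    [ a + b ] ⊝ [ a ]        ≡⟨ cong (_⊝ [ a ]) (trans (cong [_] (+-comm a b)) ([]-+ b a)) ⟩
    [ b ] ⊕ [ a ] ⊝ [ a ]    ≡⟨ //-rightDividesʳ [ a ] [ b ] ⟩
    [ b ]                    ∎

  []⊝[+] : ∀ a b → [ a ] ⊝ [ a + b ] ≡ ⊖ [ b ]
  []⊝[+] a b = trans (sym (⁻¹-anti-homo‿- [ a + b ] [ a ])) (cong ⊖_ ([+]⊝[] a b))

  ⊖[]⊝[] : ∀ a b → ⊖ [ a ] ⊝ [ b ] ≡ ⊖ [ a + b ]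
  ⊖[]⊝[] a b = trans (⁻¹-∙-comm [ a ] [ b ]) (cong ⊖_ (sym ([]-+ a b)))

  []⊝⊖[] : ∀ a b → [ a ] ⊝ ⊖ [ b ] ≡ [ a + b ]
  []⊝⊖[] a b = trans (cong ([ a ] ⊕_) (⁻¹-involutive [ b ])) (sym ([]-+ a b))

  ⊖[]⊝⊖[] : ∀ a b → ⊖ [ b + a ] ⊝ ⊖ [ a ] ≡ ⊖ [ b ]
  ⊖[]⊝⊖[] a b = begin
    ⊖ [ b + a ] ⊕ ⊖ ⊖ [ a ]    ≡⟨ ⁻¹-∙-comm [ b + a ] (⊖ [ a ]) ⟩
    ⊖ ([ b + a ] ⊝ [ a ])      ≡⟨ cong (λ x → ⊖ (x ⊝ [ a ])) (cong [_] (+-comm b a)) ⟩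
    ⊖ ([ a + b ] ⊝ [ a ])      ≡⟨ cong ⊖_ ([+]⊝[] a b) ⟩
    ⊖ [ b ]                    ∎

-- Vertices of the dihedral group D_N = ℤ/N ⋊ ℤ/2: rotations and reflections.
pattern rot a = inj₁ a
pattern ref a = inj₂ a

-- The Cayley graph of D_N with connection set {rot z | R z} ∪ {ref z | B z},
-- for a symmetric R avoiding 𝟘.  Left multiplications are automorphisms, so
-- the graph is vertex-transitive; if moreover only the identity fixes the
-- unit e, these are all automorphisms and |Aut| = |D_N| = 2N.
module DihedralCayley (N : ℕ) .{{_ : NonZero N}} (R B : Fin N → Bool)
                      (R-⊖ : ∀ z → R (Cyclic.⊖_ N z) ≡ R z) (R-𝟘 : R (Cyclic.𝟘 N) ≡ false) where
  open Cyclic N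

  D : Set
  D = Fin N ⊎ Fin N

  e : D
  e = rot 𝟘

  infix 5 _~_

  -- u ~ v iff u⁻¹ · v lies in the connection set.
  _~_ : D → D → Bool
  rot a ~ rot b = R (b ⊝ a)
  ref a ~ ref b = R (a ⊝ b)
  rot a ~ ref b = B (b ⊝ a)
  ref a ~ rot b = B (a ⊝ b)

  R-swap : ∀ a b → R (b ⊝ a) ≡ R (a ⊝ b)
  R-swap a b = trans (cong R (sym (⁻¹-anti-homo‿- a b))) (R-⊖ (a ⊝ b))

  ~-sym : ∀ u v → u ~ v ≡ v ~ u
  ~-sym (rot a) (rot b) = R-swap a b
  ~-sym (ref a) (ref b) = R-swap b a
  ~-sym (rot a) (ref b) = refl
  ~-sym (ref a) (rot b) = refl

  ~-irrefl : ∀ u → u ~ u ≡ false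
  ~-irrefl (rot a) = trans (cong R (inverseʳ a)) R-𝟘
  ~-irrefl (ref a) = trans (cong R (inverseʳ a)) R-𝟘

  toD : Fin (N + N) → D
  toD = splitAt N

  fromD : D → Fin (N + N)
  fromD = join N N

  toD-fromD : ∀ u → toD (fromD u) ≡ u
  toD-fromD = splitAt-join N N

  fromD-toD : ∀ i → fromD (toD i) ≡ i
  fromD-toD = join-splitAt N N

  fromD-injective : ∀ {u w} → fromD u ≡ fromD w → u ≡ w
  fromD-injective {u} {w} eq = trans (sym (toD-fromD u)) (trans (cong toD eq) (toD-fromD w))

  Cay : Graph
  Cay = record
    { size   = N + N
    ; adj    = λ i j → toD i ~ toD j
    ; symm   = λ i j → ~-sym (toD i) (toD j)
    ; irrefl = λ i → ~-irrefl (toD i)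
    }

  infixr 7 _·_
  infix  8 _⁻¹

  _·_ : D → D → D
  rot g · rot a = rot (g ⊕ a)
  rot g · ref a = ref (g ⊕ a)
  ref g · rot a = ref (g ⊝ a)
  ref g · ref a = rot (g ⊝ a)

  _⁻¹ : D → D
  rot g ⁻¹ = rot (⊖ g)
  ref g ⁻¹ = ref g

  ·-identityʳ : ∀ g → g · e ≡ g
  ·-identityʳ (rot g) = cong rot (identityʳ g)
  ·-identityʳ (ref g) = cong ref (⊝-identityʳ g)

  ·-inverseʳ : ∀ g u → g · (g ⁻¹ · u) ≡ u
  ·-inverseʳ (rot g) (rot a) = cong rot (\\-leftDividesˡ g a)
  ·-inverseʳ (rot g) (ref a) = cong ref (\\-leftDividesˡ g a)
  ·-inverseʳ (ref g) (rot a) = cong rot (⊝-involutive g a)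
  ·-inverseʳ (ref g) (ref a) = cong ref (⊝-involutive g a)

  ·-inverseˡ : ∀ g u → g ⁻¹ · (g · u) ≡ u
  ·-inverseˡ (rot g) (rot a) = cong rot (\\-leftDividesʳ g a)
  ·-inverseˡ (rot g) (ref a) = cong ref (\\-leftDividesʳ g a)
  ·-inverseˡ (ref g) (rot a) = cong rot (⊝-involutive g a)
  ·-inverseˡ (ref g) (ref a) = cong ref (⊝-involutive g a)

  -- Adjacency only depends on u⁻¹ · v, hence is invariant under g · _.
  ·-preserves-~ : ∀ g u v → (g · u) ~ (g · v) ≡ u ~ v
  ·-preserves-~ (rot g) (rot a) (rot b) = cong R (⊕-⊝-cancelˡ g b a)
  ·-preserves-~ (rot g) (ref a) (ref b) = cong R (⊕-⊝-cancelˡ g a b)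
  ·-preserves-~ (rot g) (rot a) (ref b) = cong B (⊕-⊝-cancelˡ g b a)
  ·-preserves-~ (rot g) (ref a) (rot b) = cong B (⊕-⊝-cancelˡ g a b)
  ·-preserves-~ (ref g) (rot a) (rot b) = cong R (⊝-⊝-cancelˡ g a b)
  ·-preserves-~ (ref g) (ref a) (ref b) = cong R (⊝-⊝-cancelˡ g b a)
  ·-preserves-~ (ref g) (rot a) (ref b) = cong B (⊝-⊝-cancelˡ g a b)
  ·-preserves-~ (ref g) (ref a) (rot b) = cong B (⊝-⊝-cancelˡ g b a)

  ·-rot-rot : ∀ g a b → (g · rot a) · rot b ≡ g · rot (a ⊕ b)
  ·-rot-rot (rot g) a b = cong rot (⊕-assoc g a b)
  ·-rot-rot (ref g) a b = cong ref (trans (⊕-assoc g (⊖ a) (⊖ b)) (cong (g ⊕_) (⁻¹-∙-comm a b)))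

  record Symmetry : Set where
    field
      to       : D → D
      from     : D → D
      to-from  : ∀ u → to (from u) ≡ u
      from-to  : ∀ u → from (to u) ≡ u
      preserve : ∀ u v → to u ~ to v ≡ u ~ v

  open Symmetry public

  to-injective : ∀ S {u w} → to S u ≡ to S w → u ≡ w
  to-injective S {u} {w} eq = trans (sym (from-to S u)) (trans (cong (from S) eq) (from-to S w))

  translation : D → Symmetry
  translation g = record
    { to = g ·_ ; from = g ⁻¹ ·_
    ; to-from = ·-inverseʳ g ; from-to = ·-inverseˡ g
    ; preserve = ·-preserves-~ g }

  _∘ₛ_ : Symmetry → Symmetry → Symmetry
  S ∘ₛ T = record
    { to       = λ u → to S (to T u)
    ; from     = λ u → from T (from S u)
    ; to-from  = λ u → trans (cong (to S) (to-from T _)) (to-from S u)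
    ; from-to  = λ u → trans (cong (from T) (from-to S _)) (from-to T u)
    ; preserve = λ u v → trans (preserve S _ _) (preserve T u v)
    }

  record Exclusive (u v w : D) : Set where
    constructor exclusive
    field
      near : u ~ w ≡ true
      far  : v ~ w ≡ false

  -- An edge uv is special when the neighbours of u outside N(v) form an
  -- independent set.  Being defined from adjacency alone, this is
  -- invariant under every symmetry.
  record Special (u v : D) : Set where
    constructor special
    field
      edge        : u ~ v ≡ true
      independent : ∀ {w w′} → Exclusive u v w → Exclusive u v w′ → w ~ w′ ≡ false

  special-preserved : ∀ S {u v} → Special u v → Special (to S u) (to S v)
  special-preserved S {u} {v} (special u~v independent) = special (trans (preserve S u v) u~v) independent′
    where
    pull : ∀ {x} w → to S x ~ w ≡ x ~ from S w
    pull {x} w = trans (cong (to S x ~_) (sym (to-from S w))) (preserve S x (from S w))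
    pull-exclusive : ∀ {w} → Exclusive (to S u) (to S v) w → Exclusive u v (from S w)
    pull-exclusive {w} (exclusive uw vw) = exclusive (trans (sym (pull w)) uw) (trans (sym (pull w)) vw)
    independent′ : ∀ {w w′} → Exclusive (to S u) (to S v) w → Exclusive (to S u) (to S v) w′ → w ~ w′ ≡ false
    independent′ {w} {w′} x x′ = begin
      w ~ w′                                ≡⟨ cong₂ _~_ (to-from S w) (to-from S w′) ⟨
      to S (from S w) ~ to S (from S w′)    ≡⟨ preserve S _ _ ⟩
      from S w ~ from S w′                  ≡⟨ independent (pull-exclusive x) (pull-exclusive x′) ⟩
      false                                 ∎
      where open ≡-Reasoning

  toAut : Symmetry → Aut Cay
  toAut S = mk↔ₛ′ to′ from′ inv₁ inv₂ , pres
    where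
    to′ from′ : Fin (N + N) → Fin (N + N)
    to′ i = fromD (to S (toD i))
    from′ i = fromD (from S (toD i))
    inv₁ : ∀ i → to′ (from′ i) ≡ i
    inv₁ i = trans (cong (λ u → fromD (to S u)) (toD-fromD _))
                   (trans (cong fromD (to-from S _)) (fromD-toD i))
    inv₂ : ∀ i → from′ (to′ i) ≡ i
    inv₂ i = trans (cong (λ u → fromD (from S u)) (toD-fromD _))
                   (trans (cong fromD (from-to S _)) (fromD-toD i))
    pres : ∀ i j → toD (to′ i) ~ toD (to′ j) ≡ toD i ~ toD j
    pres i j = trans (cong₂ _~_ (toD-fromD (to S (toD i))) (toD-fromD (to S (toD j))))
                     (preserve S (toD i) (toD j))

  toAut-fromD : ∀ S u → app Cay (toAut S) (fromD u) ≡ fromD (to S u)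
  toAut-fromD S u = cong (λ w → fromD (to S w)) (toD-fromD u)

  fromAut : Aut Cay → Symmetry
  fromAut (φ , pres) = record
    { to       = λ u → toD (φ⃗ (fromD u))
    ; from     = λ u → toD (φ⃖ (fromD u))
    ; to-from  = λ u → trans (cong (λ i → toD (φ⃗ i)) (fromD-toD _))
                             (trans (cong toD (Inverse.strictlyInverseˡ φ _)) (toD-fromD u))
    ; from-to  = λ u → trans (cong (λ i → toD (φ⃖ i)) (fromD-toD _))
                             (trans (cong toD (Inverse.strictlyInverseʳ φ _)) (toD-fromD u))
    ; preserve = λ u v → trans (pres (fromD u) (fromD v)) (cong₂ _~_ (toD-fromD u) (toD-fromD v))
    }
    where
    φ⃗ φ⃖ : Fin (N + N) → Fin (N + N)
    φ⃗ = Inverse.to φ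
    φ⃖ = Inverse.from φ

  app-fromAut : ∀ φ i → fromD (to (fromAut φ) (toD i)) ≡ app Cay φ i
  app-fromAut φ i = trans (fromD-toD _) (cong (app Cay φ) (fromD-toD i))

  ⁻¹-· : ∀ g → g ⁻¹ · g ≡ e
  ⁻¹-· g = trans (cong (g ⁻¹ ·_) (sym (·-identityʳ g))) (·-inverseˡ g e)

  vertexTransitive : VertexTransitive Cay
  vertexTransitive i j = toAut (translation (toD j) ∘ₛ translation (toD i ⁻¹)) , moves
    where
    moves : fromD (toD j · toD i ⁻¹ · toD i) ≡ j
    moves = trans (cong (λ u → fromD (toD j · u)) (⁻¹-· (toD i)))
                  (trans (cong fromD (·-identityʳ (toD j))) (fromD-toD j))

  module Regular (rigid : ∀ S → to S e ≡ e → ∀ u → to S u ≡ u) where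

    -- The symmetry g⁻¹ ∘ S fixes e for g = S e, so S = g · _.
    is-translation : ∀ S u → to S u ≡ to S e · u
    is-translation S u = trans (sym (·-inverseʳ g (to S u))) (cong (g ·_) (rigid T fixes u))
      where
      g = to S e
      T = translation (g ⁻¹) ∘ₛ S
      fixes : to T e ≡ e
      fixes = ⁻¹-· g

    fixes-e⇒identity : ∀ φ → app Cay φ (fromD e) ≡ fromD e → IsIdentity Cay φ
    fixes-e⇒identity φ fix i = begin
      app Cay φ i                        ≡⟨ app-fromAut φ i ⟨
      fromD (to S (toD i))               ≡⟨ cong fromD (rigid S fixD (toD i)) ⟩
      fromD (toD i)                      ≡⟨ fromD-toD i ⟩
      i                                  ∎
      where
      open ≡-Reasoning
      S = fromAut φ
      fixD : to S e ≡ e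
      fixD = trans (cong toD fix) (toD-fromD e)

    τ : Fin (N + N) → Aut Cay
    τ i = toAut (translation (toD i))

    τ-moves-e : ∀ i → app Cay (τ i) (fromD e) ≡ i
    τ-moves-e i = trans (toAut-fromD (translation (toD i)) e)
                        (trans (cong fromD (·-identityʳ (toD i))) (fromD-toD i))

    τ-complete : ∀ φ → SameAut Cay φ (τ (app Cay φ (fromD e)))
    τ-complete φ i = begin
      app Cay φ i                                   ≡⟨ app-fromAut φ i ⟨
      fromD (to S (toD i))                          ≡⟨ cong fromD (is-translation S (toD i)) ⟩
      fromD (to S e · toD i)                        ≡⟨⟩
      app Cay (τ (app Cay φ (fromD e))) i           ∎
      where
      open ≡-Reasoning
      S = fromAut φ

    autOrder : AutOrder Cay (N + N)
    autOrder = translations , complete , distinct , counted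
      where
      translations : List (Aut Cay)
      translations = map τ (allFin (N + N))
      complete : ∀ φ → Any.Any (SameAut Cay φ) translations
      complete φ = Any.map⁺ (Any.map (λ { refl → τ-complete φ }) (∈-allFin (app Cay φ (fromD e))))
      distinct : AllPairs.AllPairs (λ φ ψ → ¬ SameAut Cay φ ψ) translations
      distinct = AllPairs.map⁺ (AllPairs.map
        (λ {i} {j} i≢j same → i≢j (trans (sym (τ-moves-e i)) (trans (same (fromD e)) (τ-moves-e j))))
        (allFin⁺ (N + N)))
      counted : length translations ≡ N + N
      counted = trans (length-map τ (allFin (N + N))) (length-tabulate (λ i → i))

true≢false : true ≢ false
true≢false ()

contradictory : ∀ {b} → b ≡ true → b ≡ false → ⊥
contradictory b≡true b≡false = true≢false (trans (sym b≡true) b≡false)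

module _ (G : Graph) where

  clique⇒¬colorable : ∀ {c r} (v : Fin c → V G) → (∀ {i j} → i Fin.< j → adj G (v i) (v j) ≡ true) →
                      r < c → ¬ Colorable G r
  clique⇒¬colorable v clique r<c (f , proper) with pigeonhole r<c (λ i → f (v i))
  ... | i , j , i<j , same = proper (v i) (v j) (clique i<j) same

  invariant⇒¬distColorable : ∀ {r} (τ : Aut G) → ¬ IsIdentity G τ →
    (∀ f → IsProperColoring G r f → ∀ v → f (app G τ v) ≡ f v) → ¬ DistColorable G r
  invariant⇒¬distColorable τ τ≢id invariant (f , proper , distinguishing) =
    distinguishing τ τ≢id λ i v → (λ fv≡i → trans (invariant f proper v) fv≡i)
                                 , (λ fτv≡i → trans (sym (invariant f proper v)) fτv≡i)

  fresh-colour : ∀ {c} → Colorable G c → (x : V G) →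
                 (∀ φ → app G φ x ≡ x → IsIdentity G φ) → DistColorable G (suc c)
  fresh-colour {c} (f , proper) x rigid = colour , colour-proper , distinguishing
    where
    colour : V G → Fin (suc c)
    colour v with v ≟ x
    ... | yes _ = fromℕ c
    ... | no _  = inject₁ (f v)

    colour-x : colour x ≡ fromℕ c
    colour-x with x ≟ x
    ... | yes _   = refl
    ... | no x≢x = ⊥-elim (x≢x refl)

    only-x : ∀ v → colour v ≡ fromℕ c → v ≡ x
    only-x v eq with v ≟ x
    ... | yes v≡x = v≡x
    ... | no _    = ⊥-elim (fromℕ≢inject₁ (sym eq))

    colour-proper : IsProperColoring G (suc c) colour
    colour-proper u v u~v with u ≟ x | v ≟ x
    ... | yes refl | yes refl = λ _ → ⊥-elim (true≢false (trans (sym u~v) (irrefl G u)))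
    ... | yes _ | no _ = fromℕ≢inject₁
    ... | no _ | yes _ = λ eq → fromℕ≢inject₁ (sym eq)
    ... | no _ | no _  = λ eq → proper u v u~v (inject₁-injective eq)

    distinguishing : ∀ φ → ¬ IsIdentity G φ → ¬ PreservesClasses G (suc c) colour φ
    distinguishing φ φ≢id preserves = φ≢id (rigid φ (only-x _ (proj₁ (preserves (fromℕ c) x) colour-x)))

  distChromaticNumber : ∀ {c} → IsChromaticNumber G c → ¬ DistColorable G c →
                        DistColorable G (suc c) → IsDistChromaticNumber G (suc c)
  distChromaticNumber {c} (_ , fewer) ¬dist dist = dist , lower
    where
    lower : ∀ r → r < suc c → ¬ DistColorable G r
    lower r r<1+c with m≤n⇒m<n∨m≡n (s≤s⁻¹ r<1+c)
    ... | inj₁ r<c = λ (f , proper , _) → fewer r r<c (f , proper)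
    ... | inj₂ refl = ¬dist

does-true : ∀ {P : Set} (P? : Dec P) → does P? ≡ true → P
does-true (yes p) _ = p

module Construction (j q : ℕ) where
  p c N : ℕ
  p = 2 + j
  c = suc p
  N = c * (8 + q)

  instance
    c-nonZero : NonZero c
    c-nonZero = _
    N-nonZero : NonZero N
    N-nonZero = _

  open Cyclic N public

  -- All elements [ t ] or ⊖ [ t ] with t ≤ 4c that occur below are far
  -- from wrapping around: two such numbers sum to less than N.
  four-c+four-c≤N : 4 * c + 4 * c ≤ N
  four-c+four-c≤N = begin
    4 * c + 4 * c    ≡⟨ *-distribʳ-+ c 4 4 ⟨
    8 * c            ≡⟨ *-comm 8 c ⟩
    c * 8            ≤⟨ *-monoʳ-≤ c (m≤m+n 8 q) ⟩
    N                ∎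
    where open ≤-Reasoning

  small-sum : ∀ {a b} → a < 4 * c → b ≤ 4 * c → a + b < N
  small-sum a<4c b≤4c = <-≤-trans (+-mono-<-≤ a<4c b≤4c) four-c+four-c≤N

  p<c : p < c
  p<c = n<1+n p

  c≤4c : c ≤ 4 * c
  c≤4c = m≤n*m c 4

  small<N : ∀ {t} → t ≤ 4 * c → t < N
  small<N = small-sum {0} (<-≤-trans z<s c≤4c)

  InWindow : ℕ → Set
  InWindow t = 1 ≤ t × t ≤ p

  inWindow? : ∀ t → Dec (InWindow t)
  inWindow? t = (1 ≤? t) ×-dec (t ≤? p)

  InR : Fin N → Set
  InR z = InWindow (toℕ z) ⊎ InWindow (toℕ (⊖ z))

  inR? : ∀ z → Dec (InR z)
  inR? z = inWindow? (toℕ z) ⊎-dec inWindow? (toℕ (⊖ z))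

  -- R and B are opaque, so that R z and B z are rigid terms; they are only
  -- accessed through the lemmas R-true, …, B-false.
  opaque
    R : Fin N → Bool
    R z = does (inR? z)

  opaque
    unfolding R

    R-true : ∀ {z} → InR z → R z ≡ true
    R-true {z} = dec-true (inR? z)

    R-false : ∀ {z} → ¬ InR z → R z ≡ false
    R-false {z} = dec-false (inR? z)

    R-view : ∀ {z} → R z ≡ true → InR z
    R-view {z} = does-true (inR? z)

    R-⊖ : ∀ z → R (⊖ z) ≡ R z
    R-⊖ z = trans (cong (λ y → does (inWindow? (toℕ (⊖ z)) ⊎-dec inWindow? (toℕ y))) (⁻¹-involutive z))
                  (∨-comm (does (inWindow? (toℕ (⊖ z)))) (does (inWindow? (toℕ z))))

  IsB : Fin N → Set
  IsB z = z ≡ [ 0 ] ⊎ z ≡ [ c ] ⊎ z ≡ [ 3 * c ]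

  isB? : ∀ z → Dec (IsB z)
  isB? z = z ≟ [ 0 ] ⊎-dec z ≟ [ c ] ⊎-dec z ≟ [ 3 * c ]

  opaque
    B : Fin N → Bool
    B z = does (isB? z)

  opaque
    unfolding B

    B-view : ∀ {z} → B z ≡ true → IsB z
    B-view {z} = does-true (isB? z)

    B-member : ∀ {z} → IsB z → B z ≡ true
    B-member {z} = dec-true (isB? z)

    B-false : ∀ {z} → ¬ IsB z → B z ≡ false
    B-false {z} = dec-false (isB? z)

  R-𝟘 : R 𝟘 ≡ false
  R-𝟘 = R-false not-in-window
    where
    zero∉window : ∀ {x} → toℕ x ≡ 0 → ¬ InWindow (toℕ x)
    zero∉window x≡0 (1≤x , _) = <⇒≢ 1≤x (sym x≡0)
    not-in-window : ¬ InR 𝟘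
    not-in-window (inj₁ w) = zero∉window toℕ-𝟘 w
    not-in-window (inj₂ w) = zero∉window (trans (cong toℕ ε⁻¹≈ε) toℕ-𝟘) w

  R-[] : ∀ {t} → InWindow t → R [ t ] ≡ true
  R-[] {t} w = R-true
                 (inj₁ (subst InWindow (sym (toℕ-[]-small (<-trans (s≤s (proj₂ w)) (small<N c≤4c)))) w))

  R-⊖[] : ∀ {t} → InWindow t → R (⊖ [ t ]) ≡ true
  R-⊖[] w = trans (R-⊖ _) (R-[] w)

  R-[]-far : ∀ {t} → p < t → t ≤ 4 * c → R [ t ] ≡ false
  R-[]-far {t} p<t t≤4c = R-false outside
    where
    t<N : t < N
    t<N = small<N t≤4c
    p<N∸t : p < N ∸ t
    p<N∸t = m+n≤o⇒m≤o∸n (suc p) (small-sum (<-≤-trans p<c c≤4c) t≤4c)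
    outside : ¬ InR [ t ]
    outside (inj₁ (_ , t≤p)) = <⇒≱ p<t (subst (_≤ p) (toℕ-[]-small t<N) t≤p)
    outside (inj₂ (_ , ≤p)) = <⇒≱ p<N∸t (subst (_≤ p) (toℕ-⊖[] (<-trans (s≤s z≤n) p<t) t<N) ≤p)

  R-⊖[]-far : ∀ {t} → p < t → t ≤ 4 * c → R (⊖ [ t ]) ≡ false
  R-⊖[]-far p<t t≤4c = trans (R-⊖ _) (R-[]-far p<t t≤4c)

  B-[]-gap : ∀ {t} → t ≤ 4 * c → t ≢ 0 → t ≢ c → t ≢ 3 * c → B [ t ] ≡ false
  B-[]-gap {t} t≤4c t≢0 t≢c t≢3c = B-false not-B
    where
    same : ∀ {b} → b ≤ 4 * c → [ t ] ≡ [ b ] → t ≡ b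
    same b≤4c = []-injective (small<N t≤4c) (small<N b≤4c)
    not-B : ¬ IsB [ t ]
    not-B (inj₁ eq)        = t≢0 (same {0} z≤n eq)
    not-B (inj₂ (inj₁ eq)) = t≢c (same c≤4c eq)
    not-B (inj₂ (inj₂ eq)) = t≢3c (same (*-monoˡ-≤ c {3} {4} (n≤1+n 3)) eq)

  B-⊖[] : ∀ {t} → 0 < t → t ≤ 4 * c → B (⊖ [ t ]) ≡ false
  B-⊖[] {t} 0<t t≤4c = B-false not-B
    where
    differ : ∀ {b} → b < 4 * c → ⊖ [ t ] ≢ [ b ]
    differ {b} b<4c eq = []≢⊖[] {b} {t} (<-≤-trans 0<t (m≤n+m t b)) (small-sum b<4c t≤4c) (sym eq)
    not-B : ¬ IsB (⊖ [ t ])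
    not-B (inj₁ eq)        = differ {0} (<-≤-trans z<s c≤4c) eq
    not-B (inj₂ (inj₁ eq)) = differ (*-monoˡ-< c {1} {4} (s≤s (s≤s z≤n))) (trans eq (cong [_] (sym (*-identityˡ c))))
    not-B (inj₂ (inj₂ eq)) = differ (*-monoˡ-< c {3} {4} (n<1+n 3)) eq

  R-signed : ∀ {z} → R z ≡ true → Σ ℕ λ t → InWindow t × (z ≡ [ t ] ⊎ z ≡ ⊖ [ t ])
  R-signed {z} Rz with R-view Rz
  ... | inj₁ w = toℕ z , w , inj₁ (sym ([]-toℕ z))
  ... | inj₂ w = toℕ (⊖ z) , w , inj₂ (trans (sym (⁻¹-involutive z)) (cong ⊖_ (sym ([]-toℕ (⊖ z)))))

  multiple-far : ∀ k .{{_ : NonZero k}} → k ≤ 4 → p < k * c × k * c ≤ 4 * c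
  multiple-far k k≤4 = <-≤-trans p<c (m≤n*m c k) , *-monoˡ-≤ c k≤4

  B-spread : ∀ {z z′} → IsB z → IsB z′ → R (z ⊝ z′) ≡ false
  B-spread {z} (inj₁ refl) (inj₁ refl)               = trans (cong R (inverseʳ z)) R-𝟘
  B-spread {z} (inj₂ (inj₁ refl)) (inj₂ (inj₁ refl)) = trans (cong R (inverseʳ z)) R-𝟘
  B-spread {z} (inj₂ (inj₂ refl)) (inj₂ (inj₂ refl)) = trans (cong R (inverseʳ z)) R-𝟘
  B-spread (inj₂ (inj₁ refl)) (inj₁ refl) = trans (cong R (⊝-identityʳ [ c ])) (R-[]-far p<c c≤4c)
  B-spread (inj₂ (inj₂ refl)) (inj₁ refl) =
    trans (cong R (⊝-identityʳ [ 3 * c ])) (uncurry R-[]-far (multiple-far 3 (s≤s (s≤s (s≤s z≤n)))))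
  B-spread (inj₁ refl) (inj₂ (inj₁ refl)) = trans (cong R (identityˡ (⊖ [ c ]))) (R-⊖[]-far p<c c≤4c)
  B-spread (inj₁ refl) (inj₂ (inj₂ refl)) =
    trans (cong R (identityˡ (⊖ [ 3 * c ]))) (uncurry R-⊖[]-far (multiple-far 3 (s≤s (s≤s (s≤s z≤n)))))
  B-spread (inj₂ (inj₂ refl)) (inj₂ (inj₁ refl)) =
    trans (cong R ([+]⊝[] c (2 * c))) (uncurry R-[]-far (multiple-far 2 (s≤s (s≤s z≤n))))
  B-spread (inj₂ (inj₁ refl)) (inj₂ (inj₂ refl)) =
    trans (cong R ([]⊝[+] c (2 * c))) (uncurry R-⊖[]-far (multiple-far 2 (s≤s (s≤s z≤n))))

  B-R-disjoint : ∀ {z y} → IsB z → R y ≡ true → B (z ⊝ y) ≡ false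
  B-R-disjoint {z} {y} z∈B Ry = ¬-not λ B[z⊝y] →
    contradictory Ry (trans (cong R (sym (⊝-involutive z y))) (B-spread z∈B (B-view B[z⊝y])))

  open DihedralCayley N R B R-⊖ R-𝟘 public

  e~rot : ∀ x → e ~ rot x ≡ R x
  e~rot x = cong R (⊝-identityʳ x)

  e~ref : ∀ x → e ~ ref x ≡ B x
  e~ref x = cong B (⊝-identityʳ x)

  ¬special : ∀ {u v w w′} → Exclusive u v w → Exclusive u v w′ → w ~ w′ ≡ true → ¬ Special u v
  ¬special x x′ w~w′ sp = contradictory w~w′ (Special.independent sp x x′)

  1∈window : InWindow 1
  1∈window = ≤-refl , s≤s z≤n

  2∈window : InWindow 2
  2∈window = s≤s z≤n , s≤s (s≤s z≤n)

  p∈window : InWindow p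
  p∈window = s≤s z≤n , ≤-refl

  ExclusiveOfOne : D → Set
  ExclusiveOfOne w = w ≡ rot [ 1 ] ⊎ w ≡ rot (⊖ [ p ]) ⊎ Σ (Fin N) λ z → IsB z × w ≡ ref z

  exclusive-one : ∀ w → Exclusive e (rot [ 1 ]) w → ExclusiveOfOne w
  exclusive-one (ref z) (exclusive e~w _) = inj₂ (inj₂ (z , B-view (trans (sym (e~ref z)) e~w) , refl))
  exclusive-one (rot x) (exclusive e~w one≁w) with R-signed (trans (sym (e~rot x)) e~w)
  ... | 1 , _ , inj₁ refl = inj₁ refl
  ... | suc (suc s) , (_ , 2+s≤p) , inj₁ refl =
    ⊥-elim (contradictory (R-[] (s≤s z≤n , ≤-trans (n≤1+n _) 2+s≤p))
                          (trans (cong R (sym ([+]⊝[] 1 (suc s)))) one≁w))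
  ... | t , (_ , t≤p) , inj₂ refl with m≤n⇒m<n∨m≡n t≤p
  ...   | inj₂ refl = inj₂ (inj₁ refl)
  ...   | inj₁ t<p  = ⊥-elim (contradictory (R-⊖[] (m≤n+m 1 t , subst (_≤ p) (+-comm 1 t) t<p))
                                           (trans (cong R (sym (⊖[]⊝[] t 1))) one≁w))

  -- rot [ 1 ]: its exclusive neighbours rot [ 1 ], rot (⊖ [ p ]) and the
  -- reflections ref z (z ∈ B) are pairwise non-adjacent.
  special-one : Special e (rot [ 1 ])
  special-one = special (trans (e~rot [ 1 ]) (R-[] 1∈window)) independent
    where
    independent : ∀ {w w′} → Exclusive e (rot [ 1 ]) w → Exclusive e (rot [ 1 ]) w′ → w ~ w′ ≡ false
    independent {w} {w′} x x′ = go (exclusive-one w x) (exclusive-one w′ x′)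
      where
      go : ExclusiveOfOne w → ExclusiveOfOne w′ → w ~ w′ ≡ false
      go (inj₁ refl) _ = Exclusive.far x′
      go _ (inj₁ refl) = trans (~-sym w _) (Exclusive.far x)
      go (inj₂ (inj₁ refl)) (inj₂ (inj₁ refl)) = ~-irrefl w
      go (inj₂ (inj₁ refl)) (inj₂ (inj₂ (z , z∈B , refl))) = B-R-disjoint z∈B (R-⊖[] p∈window)
      go (inj₂ (inj₂ (z , z∈B , refl))) (inj₂ (inj₁ refl)) = B-R-disjoint z∈B (R-⊖[] p∈window)
      go (inj₂ (inj₂ (z , z∈B , refl))) (inj₂ (inj₂ (z′ , z′∈B , refl))) = B-spread z∈B z′∈B

  far-sum : ∀ {u t} → 1 + j ≤ u → u ≤ p → 2 ≤ t → t ≤ p → p < u + t × u + t ≤ 4 * c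
  far-sum {u} {t} 1+j≤u u≤p 2≤t t≤p =
    subst (_≤ u + t) (+-comm (1 + j) 2) (+-mono-≤ 1+j≤u 2≤t) ,
    ≤-trans (+-mono-≤ (≤-trans u≤p (n≤1+n p)) (≤-trans t≤p (n≤1+n p))) (+-monoʳ-≤ c (m≤m+n c _))

  p-1∈window : InWindow (1 + j)
  p-1∈window = s≤s z≤n , n≤1+n _

  -- The only special edges at e lead to rot [ 1 ] and rot (⊖ [ 1 ]):
  -- every other neighbour has two adjacent exclusive neighbours.
  special-from-e : ∀ w → Special e w → w ≡ rot [ 1 ] ⊎ w ≡ rot (⊖ [ 1 ])
  special-from-e (rot x) sp with R-signed (trans (sym (e~rot x)) (Special.edge sp))
  ... | 1 , _ , inj₁ refl = inj₁ refl
  ... | 1 , _ , inj₂ refl = inj₂ refl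
  ... | suc (suc s) , (_ , t≤p) , inj₁ refl =
    ⊥-elim (¬special (far p-1∈window ≤-refl) (far p∈window (n≤1+n _)) adjacent sp)
    where
    far : ∀ {u} → InWindow u → 1 + j ≤ u → Exclusive e (rot [ 2 + s ]) (rot (⊖ [ u ]))
    far {u} u∈window 1+j≤u =
      exclusive (trans (e~rot _) (R-⊖[] u∈window))
      (trans (cong R (⊖[]⊝[] u (2 + s))) (uncurry R-⊖[]-far (far-sum 1+j≤u (proj₂ u∈window) (s≤s (s≤s z≤n)) t≤p)))
    adjacent : rot (⊖ [ 1 + j ]) ~ rot (⊖ [ 2 + j ]) ≡ true
    adjacent = trans (cong R (⊖[]⊝⊖[] (1 + j) 1)) (R-⊖[] 1∈window)
  ... | suc (suc s) , (_ , t≤p) , inj₂ refl =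
    ⊥-elim (¬special (far p-1∈window ≤-refl) (far p∈window (n≤1+n _)) adjacent sp)
    where
    far : ∀ {u} → InWindow u → 1 + j ≤ u → Exclusive e (rot (⊖ [ 2 + s ])) (rot [ u ])
    far {u} u∈window 1+j≤u =
      exclusive (trans (e~rot _) (R-[] u∈window))
      (trans (cong R ([]⊝⊖[] u (2 + s))) (uncurry R-[]-far (far-sum 1+j≤u (proj₂ u∈window) (s≤s (s≤s z≤n)) t≤p)))
    adjacent : rot [ 1 + j ] ~ rot [ 2 + j ] ≡ true
    adjacent = trans (cong R (trans (cong (λ n → [ n ] ⊝ [ 1 + j ]) (+-comm 1 (1 + j))) ([+]⊝[] (1 + j) 1)))
                     (R-[] 1∈window)
  special-from-e (ref z) sp = ⊥-elim (¬special (exclusive-rot 1∈window) (exclusive-rot 2∈window) adjacent sp)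
    where
    z∈B : IsB z
    z∈B = B-view (trans (sym (e~ref z)) (Special.edge sp))
    exclusive-rot : ∀ {s} → InWindow s → Exclusive e (ref z) (rot [ s ])
    exclusive-rot s∈window = exclusive (trans (e~rot _) (R-[] s∈window)) (B-R-disjoint z∈B (R-[] s∈window))
    adjacent : rot [ 1 ] ~ rot [ 2 ] ≡ true
    adjacent = trans (cong R ([+]⊝[] 1 1)) (R-[] 1∈window)

keep-direction : ∀ {X : Set} (f g : X → X) → (∀ x → g (f x) ≡ x) → (h : ℕ → X) →
                 (∀ n → h (suc n) ≡ f (h n) ⊎ h (suc n) ≡ g (h n)) →
                 (∀ n → h (suc (suc n)) ≢ h n) →
                 h 1 ≡ f (h 0) → ∀ n → h (suc n) ≡ f (h n)
keep-direction f g gf h step no-return first zero = first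
keep-direction f g gf h step no-return first (suc n) with step (suc n)
... | inj₁ forward = forward
... | inj₂ back = ⊥-elim (no-return n (trans back (trans (cong g previous) (gf (h n)))))
  where
  previous : h (suc n) ≡ f (h n)
  previous = keep-direction f g gf h step no-return first n

one-direction : ∀ {X : Set} (f g : X → X) → (∀ x → g (f x) ≡ x) → (∀ x → f (g x) ≡ x) → (h : ℕ → X) →
                (∀ n → h (suc n) ≡ f (h n) ⊎ h (suc n) ≡ g (h n)) →
                (∀ n → h (suc (suc n)) ≢ h n) →
                (∀ n → h (suc n) ≡ f (h n)) ⊎ (∀ n → h (suc n) ≡ g (h n))
one-direction f g gf fg h step no-return with step 0
... | inj₁ first = inj₁ (keep-direction f g gf h step no-return first)
... | inj₂ first = inj₂ (keep-direction g f fg h (λ n → swap (step n)) no-return first)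

module Rigidity (j q : ℕ) where
  open Construction j q

  next prev : D → D
  next u = u · rot [ 1 ]
  prev u = u · rot (⊖ [ 1 ])

  prev-next : ∀ u → prev (next u) ≡ u
  prev-next u = trans (·-rot-rot u [ 1 ] (⊖ [ 1 ])) (trans (cong (λ x → u · rot x) (inverseʳ [ 1 ])) (·-identityʳ u))

  next-prev : ∀ u → next (prev u) ≡ u
  next-prev u = trans (·-rot-rot u (⊖ [ 1 ]) [ 1 ]) (trans (cong (λ x → u · rot x) (inverseˡ [ 1 ])) (·-identityʳ u))

  special-next : ∀ u → Special u (next u)
  special-next u = subst (λ x → Special x (next u)) (·-identityʳ u) (special-preserved (translation u) special-one)

  special-step : ∀ {u v} → Special u v → v ≡ next u ⊎ v ≡ prev u
  special-step {u} {v} sp = Data.Sum.map back back (special-from-e (u ⁻¹ · v) at-e)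
    where
    at-e : Special e (u ⁻¹ · v)
    at-e = subst (λ x → Special x (u ⁻¹ · v)) (⁻¹-· u) (special-preserved (translation (u ⁻¹)) sp)
    back : ∀ {x} → u ⁻¹ · v ≡ x → v ≡ u · x
    back eq = trans (sym (·-inverseʳ u v)) (cong (u ·_) eq)

  succ-step : ∀ g n → g · rot [ suc n ] ≡ next (g · rot [ n ])
  succ-step g n = sym (trans (·-rot-rot g [ n ] [ 1 ]) (cong (λ x → g · rot x) (trans (sym ([]-+ n 1)) (cong [_] (+-comm n 1)))))

  2<N : 2 < N
  2<N = small<N (≤-trans (s≤s (s≤s z≤n)) c≤4c)

  no-return : ∀ g n → g · rot [ suc (suc n) ] ≢ g · rot [ n ]
  no-return g n eq = 1+n≢0 ([]-injective 2<N 0<N [2]≡𝟘)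
    where
    [2]≡𝟘 : [ 2 ] ≡ 𝟘
    [2]≡𝟘 = ∙-cancelʳ [ n ] [ 2 ] 𝟘 (begin
      [ 2 ] ⊕ [ n ]            ≡⟨ []-+ 2 n ⟨
      [ 2 + n ]                ≡⟨ inj₁-injective (to-injective (translation g) eq) ⟩
      [ n ]                    ≡⟨ identityˡ [ n ] ⟨
      𝟘 ⊕ [ n ]                ∎)
      where open ≡-Reasoning

  forward : (h : ℕ → D) → (∀ n → h (suc n) ≡ next (h n)) → ∀ n → h n ≡ h 0 · rot [ n ]
  forward h step zero = sym (·-identityʳ (h 0))
  forward h step (suc n) = begin
    h (suc n)                      ≡⟨ step n ⟩
    next (h n)                     ≡⟨ cong next (forward h step n) ⟩
    next (h 0 · rot [ n ])         ≡⟨ succ-step (h 0) n ⟨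
    h 0 · rot [ suc n ]            ∎
    where open ≡-Reasoning

  backward : (h : ℕ → D) → (∀ n → h (suc n) ≡ prev (h n)) → ∀ n → h n ≡ h 0 · rot (⊖ [ n ])
  backward h step zero = sym (trans (cong (λ x → h 0 · rot x) ε⁻¹≈ε) (·-identityʳ (h 0)))
  backward h step (suc n) = begin
    h (suc n)                          ≡⟨ step n ⟩
    prev (h n)                         ≡⟨ cong prev (backward h step n) ⟩
    prev (h 0 · rot (⊖ [ n ]))         ≡⟨ ·-rot-rot (h 0) (⊖ [ n ]) (⊖ [ 1 ]) ⟩
    h 0 · rot (⊖ [ n ] ⊝ [ 1 ])        ≡⟨ cong (λ x → h 0 · rot x) (⊖[]⊝[] n 1) ⟩
    h 0 · rot (⊖ [ n + 1 ])            ≡⟨ cong (λ m → h 0 · rot (⊖ [ m ])) (+-comm n 1) ⟩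
    h 0 · rot (⊖ [ suc n ])            ∎
    where open ≡-Reasoning

  -- A symmetry maps each coset walk g · rot x either to S g · rot x or to
  -- S g · rot (⊖ x): special edges go to special edges, so the image walk
  -- moves by next or prev at each step and, being injective, always the
  -- same way.
  Forward Backward : Symmetry → D → Set
  Forward S g = ∀ x → to S (g · rot x) ≡ to S g · rot x
  Backward S g = ∀ x → to S (g · rot x) ≡ to S g · rot (⊖ x)

  walk-direction : ∀ S g → Forward S g ⊎ Backward S g
  walk-direction S g = conclude (one-direction next prev prev-next next-prev h step returns)
    where
    open ≡-Reasoning
    h : ℕ → D
    h n = to S (g · rot [ n ])
    h0 : h 0 ≡ to S g
    h0 = cong (to S) (·-identityʳ g)
    step : ∀ n → h (suc n) ≡ next (h n) ⊎ h (suc n) ≡ prev (h n)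
    step n = special-step (special-preserved S (subst (Special (g · rot [ n ])) (sym (succ-step g n))
                                                      (special-next (g · rot [ n ]))))
    returns : ∀ n → h (suc (suc n)) ≢ h n
    returns n eq = no-return g n (to-injective S eq)
    conclude : (∀ n → h (suc n) ≡ next (h n)) ⊎ (∀ n → h (suc n) ≡ prev (h n)) → Forward S g ⊎ Backward S g
    conclude (inj₁ forwards) = inj₁ λ x → begin
      to S (g · rot x)               ≡⟨ cong (λ y → to S (g · rot y)) ([]-toℕ x) ⟨
      h (toℕ x)                      ≡⟨ forward h forwards (toℕ x) ⟩
      h 0 · rot [ toℕ x ]            ≡⟨ cong₂ (λ u y → u · rot y) h0 ([]-toℕ x) ⟩
      to S g · rot x                 ∎
    conclude (inj₂ backwards) = inj₂ λ x → begin
      to S (g · rot x)               ≡⟨ cong (λ y → to S (g · rot y)) ([]-toℕ x) ⟨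
      h (toℕ x)                      ≡⟨ backward h backwards (toℕ x) ⟩
      h 0 · rot (⊖ [ toℕ x ])        ≡⟨ cong₂ (λ u y → u · rot (⊖ y)) h0 ([]-toℕ x) ⟩
      to S g · rot (⊖ x)             ∎

  2c≤4c : 2 * c ≤ 4 * c
  2c≤4c = *-monoˡ-≤ c {2} {4} (s≤s (s≤s z≤n))

  B-2 : B [ 2 ] ≡ false
  B-2 = B-[]-gap (≤-trans (s≤s (s≤s z≤n)) c≤4c) (λ ()) (λ ()) (λ ())

  B-2c : B [ 2 * c ] ≡ false
  B-2c = B-[]-gap 2c≤4c (λ ()) (≢-sym (<⇒≢ (m<m+n c z<s))) (<⇒≢ (m<n+m (2 * c) {c} z<s))

  B-4c : B [ 4 * c ] ≡ false
  B-4c = B-[]-gap ≤-refl (λ ()) (≢-sym (<⇒≢ (m<m+n c z<s))) (≢-sym (<⇒≢ (m<n+m (3 * c) {c} z<s)))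

  e·rot : ∀ x → e · rot x ≡ rot x
  e·rot x = cong rot (identityˡ x)

  -- A symmetry fixing e fixes or negates all rotations and shifts or
  -- mirrors all reflections; the asymmetric set B rules out everything
  -- but the identity.
  module FixingE (S : Symmetry) (fix : to S e ≡ e) where
    open ≡-Reasoning

    B-preserved : ∀ {y z} → to S (ref y) ≡ ref z → IsB y → IsB z
    B-preserved {y} {z} image y∈B = B-view (begin
      B z                        ≡⟨ e~ref z ⟨
      e ~ ref z                  ≡⟨ cong₂ _~_ fix image ⟨
      to S e ~ to S (ref y)      ≡⟨ preserve S e (ref y) ⟩
      e ~ ref y                  ≡⟨ e~ref y ⟩
      B y                        ≡⟨ B-member y∈B ⟩
      true                       ∎)

    rotations : (∀ x → to S (rot x) ≡ rot x) ⊎ (∀ x → to S (rot x) ≡ rot (⊖ x))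
    rotations = Data.Sum.map fixed negated (walk-direction S e)
      where
      fixed : Forward S e → ∀ x → to S (rot x) ≡ rot x
      fixed fw x = begin
        to S (rot x)          ≡⟨ cong (to S) (e·rot x) ⟨
        to S (e · rot x)      ≡⟨ fw x ⟩
        to S e · rot x        ≡⟨ cong (_· rot x) fix ⟩
        e · rot x             ≡⟨ e·rot x ⟩
        rot x                 ∎
      negated : Backward S e → ∀ x → to S (rot x) ≡ rot (⊖ x)
      negated bw x = begin
        to S (rot x)          ≡⟨ cong (to S) (e·rot x) ⟨
        to S (e · rot x)      ≡⟨ bw x ⟩
        to S e · rot (⊖ x)    ≡⟨ cong (_· rot (⊖ x)) fix ⟩
        e · rot (⊖ x)         ≡⟨ e·rot (⊖ x) ⟩
        rot (⊖ x)             ∎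

    -- Every rotation is the image of a rotation, so ref 𝟘 maps to a reflection.
    rotation-preimage : ∀ y → Σ (Fin N) λ x → to S (rot x) ≡ rot y
    rotation-preimage y = Data.Sum.[ (λ fixed → y , fixed y)
                                   , (λ negated → ⊖ y , trans (negated (⊖ y)) (cong rot (⁻¹-involutive y))) ] rotations

    reflection-image : Σ (Fin N) λ v → to S (ref 𝟘) ≡ ref v
    reflection-image = reflection (to S (ref 𝟘)) refl
      where
      reflection : ∀ u → to S (ref 𝟘) ≡ u → Σ (Fin N) λ v → to S (ref 𝟘) ≡ ref v
      reflection (ref v) eq = v , eq
      reflection (rot y) eq = ⊥-elim (ref≢rot (to-injective S (trans eq (sym (proj₂ (rotation-preimage y))))))
        where
        ref≢rot : ∀ {a b : Fin N} → ref a ≢ rot b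
        ref≢rot ()

    v : Fin N
    v = proj₁ reflection-image

    reflections : (∀ y → to S (ref y) ≡ ref (v ⊕ y)) ⊎ (∀ y → to S (ref y) ≡ ref (v ⊝ y))
    reflections = Data.Sum.map shifted mirrored (walk-direction S (ref 𝟘))
      where
      ref𝟘·rot⊖ : ∀ y → ref 𝟘 · rot (⊖ y) ≡ ref y
      ref𝟘·rot⊖ y = cong ref (trans (identityˡ (⊖ ⊖ y)) (⁻¹-involutive y))
      shifted : Forward S (ref 𝟘) → ∀ y → to S (ref y) ≡ ref (v ⊕ y)
      shifted fw y = begin
        to S (ref y)                      ≡⟨ cong (to S) (ref𝟘·rot⊖ y) ⟨
        to S (ref 𝟘 · rot (⊖ y))          ≡⟨ fw (⊖ y) ⟩
        to S (ref 𝟘) · rot (⊖ y)          ≡⟨ cong (_· rot (⊖ y)) (proj₂ reflection-image) ⟩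
        ref (v ⊝ ⊖ y)                     ≡⟨ cong (λ x → ref (v ⊕ x)) (⁻¹-involutive y) ⟩
        ref (v ⊕ y)                       ∎
      mirrored : Backward S (ref 𝟘) → ∀ y → to S (ref y) ≡ ref (v ⊝ y)
      mirrored bw y = begin
        to S (ref y)                      ≡⟨ cong (to S) (ref𝟘·rot⊖ y) ⟨
        to S (ref 𝟘 · rot (⊖ y))          ≡⟨ bw (⊖ y) ⟩
        to S (ref 𝟘) · rot (⊖ ⊖ y)        ≡⟨ cong (_· rot (⊖ ⊖ y)) (proj₂ reflection-image) ⟩
        ref (v ⊝ ⊖ ⊖ y)                   ≡⟨ cong (λ x → ref (v ⊝ x)) (⁻¹-involutive y) ⟩
        ref (v ⊝ y)                       ∎

    v∈B : IsB v
    v∈B = B-preserved (proj₂ reflection-image) (inj₁ refl)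

    ∉B : ∀ {z} → B z ≡ false → ¬ IsB z
    ∉B Bz≡false z∈B = contradictory (B-member z∈B) Bz≡false

    -- Shifting B by v keeps c and 3c inside B only for v = 0.
    shift-trivial : (∀ y → to S (ref y) ≡ ref (v ⊕ y)) → v ≡ 𝟘
    shift-trivial shifted = only-zero v∈B (B-preserved (shifted [ c ]) (inj₂ (inj₁ refl)))
                                         (B-preserved (shifted [ 3 * c ]) (inj₂ (inj₂ refl)))
      where
      only-zero : ∀ {w} → IsB w → IsB (w ⊕ [ c ]) → IsB (w ⊕ [ 3 * c ]) → w ≡ 𝟘
      only-zero (inj₁ w≡0) _ _ = w≡0
      only-zero (inj₂ (inj₁ refl)) _ 4c∈B = ⊥-elim (∉B B-4c (subst IsB (sym ([]-+ c (3 * c))) 4c∈B))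
      only-zero (inj₂ (inj₂ refl)) 4c∈B _ =
        ⊥-elim (∉B B-4c (subst IsB (trans (⊕-comm [ 3 * c ] [ c ]) (sym ([]-+ c (3 * c)))) 4c∈B))

    -- Mirroring B by v never keeps c and 3c inside B.
    ¬mirrored : ¬ (∀ y → to S (ref y) ≡ ref (v ⊝ y))
    ¬mirrored mirrored = never v∈B (B-preserved (mirrored [ c ]) (inj₂ (inj₁ refl)))
                                   (B-preserved (mirrored [ 3 * c ]) (inj₂ (inj₂ refl)))
      where
      never : ∀ {w} → IsB w → IsB (w ⊝ [ c ]) → IsB (w ⊝ [ 3 * c ]) → ⊥
      never (inj₁ refl) -c∈B _ = ∉B (B-⊖[] z<s c≤4c) (subst IsB (identityˡ (⊖ [ c ])) -c∈B)
      never (inj₂ (inj₁ refl)) _ -2c∈B = ∉B (B-⊖[] z<s 2c≤4c) (subst IsB ([]⊝[+] c (2 * c)) -2c∈B)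
      never (inj₂ (inj₂ refl)) 2c∈B _ = ∉B B-2c (subst IsB ([+]⊝[] c (2 * c)) 2c∈B)

    -- Negating rotations while fixing reflections breaks the edge rot [ 1 ] ~ ref [ 1 ].
    ¬negated : (∀ y → to S (ref y) ≡ ref (v ⊕ y)) → ¬ (∀ x → to S (rot x) ≡ rot (⊖ x))
    ¬negated shifted negated = true≢false (begin
      true                                ≡⟨ B-member (inj₁ refl) ⟨
      B 𝟘                                 ≡⟨ cong B (inverseʳ [ 1 ]) ⟨
      rot [ 1 ] ~ ref [ 1 ]               ≡⟨ preserve S (rot [ 1 ]) (ref [ 1 ]) ⟨
      to S (rot [ 1 ]) ~ to S (ref [ 1 ]) ≡⟨ cong₂ _~_ (negated [ 1 ]) (shifted [ 1 ]) ⟩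
      B ((v ⊕ [ 1 ]) ⊝ ⊖ [ 1 ])           ≡⟨ cong (λ w → B ((w ⊕ [ 1 ]) ⊝ ⊖ [ 1 ])) (shift-trivial shifted) ⟩
      B ((𝟘 ⊕ [ 1 ]) ⊝ ⊖ [ 1 ])           ≡⟨ cong (λ w → B (w ⊝ ⊖ [ 1 ])) (identityˡ [ 1 ]) ⟩
      B ([ 1 ] ⊝ ⊖ [ 1 ])                 ≡⟨ cong B ([]⊝⊖[] 1 1) ⟩
      B [ 2 ]                             ≡⟨ B-2 ⟩
      false                               ∎)

    identity : ∀ u → to S u ≡ u
    identity = conclude rotations reflections
      where
      conclude : (∀ x → to S (rot x) ≡ rot x) ⊎ (∀ x → to S (rot x) ≡ rot (⊖ x)) →
                 (∀ y → to S (ref y) ≡ ref (v ⊕ y)) ⊎ (∀ y → to S (ref y) ≡ ref (v ⊝ y)) →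
                 ∀ u → to S u ≡ u
      conclude _ (inj₂ mirrored) = ⊥-elim (¬mirrored mirrored)
      conclude (inj₂ negated) (inj₁ shifted) = ⊥-elim (¬negated shifted negated)
      conclude (inj₁ fixed) (inj₁ shifted) (rot x) = fixed x
      conclude (inj₁ fixed) (inj₁ shifted) (ref y) =
        trans (shifted y) (cong ref (trans (cong (_⊕ y) (shift-trivial shifted)) (identityˡ y)))

module Colouring (j q : ℕ) where
  open Construction j q
  open Rigidity j q
  module ℤc = Cyclic c

  -- Reduction modulo c, a homomorphism ℤ/N → ℤ/c since c ∣ N.
  π : Fin N → Fin c
  π x = ℤc.[ toℕ x ]

  π-[] : ∀ t → π [ t ] ≡ ℤc.[ t ]
  π-[] t = toℕ-injective (begin
    toℕ ℤc.[ toℕ [ t ] ]     ≡⟨ ℤc.toℕ-[] (toℕ [ t ]) ⟩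
    toℕ [ t ] % c            ≡⟨ cong (_% c) (toℕ-[] t) ⟩
    t % N % c                ≡⟨ m∣n⇒o%n%m≡o%m c N t (m∣m*n (8 + q)) ⟩
    t % c                    ≡⟨ ℤc.toℕ-[] t ⟨
    toℕ ℤc.[ t ]             ∎)
    where open ≡-Reasoning

  π-⊕ : ∀ x y → π (x ⊕ y) ≡ π x ℤc.⊕ π y
  π-⊕ x y = trans (π-[] (toℕ x + toℕ y)) (ℤc.[]-+ (toℕ x) (toℕ y))

  π-⊖ : ∀ x → π (⊖ x) ≡ ℤc.⊖ π x
  π-⊖ x = ℤc.inverseʳ-unique (π x) (π (⊖ x)) (trans (sym (π-⊕ x (⊖ x))) (trans (cong π (inverseʳ x)) (π-[] 0)))

  π-⊝ : ∀ x y → π (x ⊝ y) ≡ π x ℤc.⊝ π y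
  π-⊝ x y = trans (π-⊕ x (⊖ y)) (cong (π x ℤc.⊕_) (π-⊖ y))

  [t]c≢𝟘 : ∀ {t} → InWindow t → ℤc.[ t ] ≢ ℤc.𝟘
  [t]c≢𝟘 {t} (1≤t , t≤p) eq = <⇒≢ 1≤t (sym (ℤc.[]-injective (s≤s t≤p) ℤc.0<N eq))

  π-R : ∀ {z} → R z ≡ true → π z ≢ ℤc.𝟘
  π-R Rz with R-signed Rz
  ... | t , t∈window , inj₁ refl = λ eq → [t]c≢𝟘 t∈window (trans (sym (π-[] t)) eq)
  ... | t , t∈window , inj₂ refl = λ eq → [t]c≢𝟘 t∈window (begin
    ℤc.[ t ]                 ≡⟨ ℤc.⁻¹-involutive _ ⟨
    ℤc.⊖ ℤc.⊖ ℤc.[ t ]       ≡⟨ cong ℤc.⊖_ (trans (cong ℤc.⊖_ (sym (π-[] t))) (sym (π-⊖ [ t ]))) ⟩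
    ℤc.⊖ π (⊖ [ t ])         ≡⟨ cong ℤc.⊖_ eq ⟩
    ℤc.⊖ ℤc.𝟘                ≡⟨ ℤc.ε⁻¹≈ε ⟩
    ℤc.𝟘                     ∎)
    where open ≡-Reasoning

  zero-residue : ∀ {t} → t % c ≡ 0 → ℤc.[ t ] ≡ ℤc.𝟘
  zero-residue {t} t%c≡0 = toℕ-injective (trans (ℤc.toℕ-[] t) (trans t%c≡0 (sym ℤc.toℕ-𝟘)))

  π-B : ∀ {z} → IsB z → π z ≡ ℤc.𝟘
  π-B (inj₁ refl)        = π-[] 0
  π-B (inj₂ (inj₁ refl)) = trans (π-[] c) (zero-residue {c} (n%n≡0 c))
  π-B (inj₂ (inj₂ refl)) = trans (π-[] (3 * c)) (zero-residue {3 * c} (m*n%n≡0 3 c))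

  colour : D → Fin c
  colour (rot a) = π a
  colour (ref a) = π a ℤc.⊕ ℤc.[ 1 ]

  one≢𝟘 : ℤc.[ 1 ] ≢ ℤc.𝟘
  one≢𝟘 = [t]c≢𝟘 1∈window

  ⊕one≢ : ∀ x → x ℤc.⊕ ℤc.[ 1 ] ≢ x
  ⊕one≢ x eq = one≢𝟘 (ℤc.∙-cancelˡ x _ _ (trans eq (sym (ℤc.identityʳ x))))

  same-residue : ∀ {x y} → π x ≡ π y → π (y ⊝ x) ≡ ℤc.𝟘
  same-residue {x} {y} eq = trans (π-⊝ y x) (ℤc.x≈y⇒x∙y⁻¹≈ε (sym eq))

  residue-equal : ∀ {x y} → π (y ⊝ x) ≡ ℤc.𝟘 → π x ≡ π y
  residue-equal {x} {y} eq = sym (ℤc.x∙y⁻¹≈ε⇒x≈y (π y) (π x) (trans (sym (π-⊝ y x)) eq))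

  colour-proper : ∀ u v → u ~ v ≡ true → colour u ≢ colour v
  colour-proper (rot a) (rot b) Rba eq = π-R Rba (same-residue {a} {b} eq)
  colour-proper (ref a) (ref b) Rab eq = π-R Rab (same-residue {b} {a} (sym (ℤc.∙-cancelʳ ℤc.[ 1 ] (π a) (π b) eq)))
  colour-proper (rot a) (ref b) Bba eq =
    ⊕one≢ (π a) (trans (cong (ℤc._⊕ ℤc.[ 1 ]) (residue-equal {a} {b} (π-B (B-view Bba)))) (sym eq))
  colour-proper (ref a) (rot b) Bab eq =
    ⊕one≢ (π b) (trans (cong (ℤc._⊕ ℤc.[ 1 ]) (residue-equal {b} {a} (π-B (B-view Bab)))) eq)

  colorable : Colorable Cay c
  colorable = (λ i → colour (toD i)) , λ i j adj → colour-proper (toD i) (toD j) adj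

  adj-fromD : ∀ u w → adj Cay (fromD u) (fromD w) ≡ u ~ w
  adj-fromD u w = cong₂ _~_ (toD-fromD u) (toD-fromD w)

  window-edge : ∀ g {i j} → i < j → j ∸ i ≤ p → g · rot [ i ] ~ g · rot [ j ] ≡ true
  window-edge g {i} {j} i<j j∸i≤p = begin
    g · rot [ i ] ~ g · rot [ j ]    ≡⟨ ·-preserves-~ g (rot [ i ]) (rot [ j ]) ⟩
    R ([ j ] ⊝ [ i ])                ≡⟨ cong (λ n → R ([ n ] ⊝ [ i ])) (m+[n∸m]≡n (<⇒≤ i<j)) ⟨
    R ([ i + (j ∸ i) ] ⊝ [ i ])      ≡⟨ cong R ([+]⊝[] i (j ∸ i)) ⟩
    R [ j ∸ i ]                      ≡⟨ R-[] (m<n⇒0<n∸m i<j , j∸i≤p) ⟩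
    true                             ∎
    where open ≡-Reasoning

  -- The c rotations rot [ 0 ], …, rot [ p ] form a clique.
  lower-bound : ∀ r → r < c → ¬ Colorable Cay r
  lower-bound r = clique⇒¬colorable Cay (λ i → fromD (e · rot [ toℕ i ])) clique
    where
    clique : ∀ {i k : Fin c} → i Fin.< k → adj Cay (fromD (e · rot [ toℕ i ])) (fromD (e · rot [ toℕ k ])) ≡ true
    clique {i} {k} i<k = trans (adj-fromD (e · rot [ toℕ i ]) (e · rot [ toℕ k ]))
                               (window-edge e i<k (≤-trans (m∸n≤m (toℕ k) (toℕ i)) (s≤s⁻¹ (toℕ<n k))))

  chromatic : IsChromaticNumber Cay c
  chromatic = colorable , lower-bound

  window-ends : ∀ {i k} → i < k → k ≤ c → c ≤ k ∸ i → i ≡ 0 × k ≡ c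
  window-ends {i} {k} i<k k≤c c≤k∸i = +-cancelʳ-≡ k i 0 i+k≡k , k≡c
    where
    k∸i≤k : k ∸ i ≤ k
    k∸i≤k = m∸n≤m k i
    k≡c : k ≡ c
    k≡c = ≤-antisym k≤c (≤-trans c≤k∸i k∸i≤k)
    k∸i≡k : k ∸ i ≡ k
    k∸i≡k = ≤-antisym k∸i≤k (subst (_≤ k ∸ i) (sym k≡c) c≤k∸i)
    i+k≡k : i + k ≡ k
    i+k≡k = trans (cong (i +_) (sym k∸i≡k)) (m+[n∸m]≡n (<⇒≤ i<k))

  -- In a proper c-colouring, g and g · rot [ c ] share their colour: among
  -- g · rot [ 0 ], …, g · rot [ c ] two share a colour, and all pairs but
  -- the two ends are adjacent.
  period : ∀ f → IsProperColoring Cay c f → ∀ g → f (fromD (g · rot [ c ])) ≡ f (fromD g)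
  period f proper g = collision (pigeonhole (n<1+n c) (λ i → f (vertex (toℕ i))))
    where
    vertex : ℕ → Fin (N + N)
    vertex i = fromD (g · rot [ i ])
    collision : (Σ (Fin (suc c)) λ i → Σ (Fin (suc c)) λ k → i Fin.< k × f (vertex (toℕ i)) ≡ f (vertex (toℕ k))) →
                f (vertex c) ≡ f (fromD g)
    collision (i , k , i<k , same) with toℕ k ∸ toℕ i ≤? p
    ... | yes close = ⊥-elim (proper (vertex (toℕ i)) (vertex (toℕ k))
                                     (trans (adj-fromD (g · rot [ toℕ i ]) (g · rot [ toℕ k ])) (window-edge g i<k close)) same)
    ... | no far with window-ends i<k (s≤s⁻¹ (toℕ<n k)) (≰⇒> far)
    ...   | i≡0 , k≡c = sym (begin
      f (fromD g)                ≡⟨ cong (λ u → f (fromD u)) (·-identityʳ g) ⟨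
      f (vertex 0)               ≡⟨ cong (λ n → f (vertex n)) i≡0 ⟨
      f (vertex (toℕ i))         ≡⟨ same ⟩
      f (vertex (toℕ k))         ≡⟨ cong (λ n → f (vertex n)) k≡c ⟩
      f (vertex c)               ∎)
      where open ≡-Reasoning

  ρ : Aut Cay
  ρ = toAut (translation (rot [ c ]))

  ρ-invariant : ∀ f → IsProperColoring Cay c f → ∀ i → f (app Cay ρ i) ≡ f i
  ρ-invariant f proper i = trans (invariant (toD i)) (cong f (fromD-toD i))
    where
    -- For reflections use rot [ c ] · ref a = ref ([ c ] ⊕ a), whose right
    -- multiple by rot [ c ] is ref a again.
    invariant : ∀ u → f (fromD (rot [ c ] · u)) ≡ f (fromD u)
    invariant (rot a) = trans (cong (λ x → f (fromD (rot x))) (⊕-comm [ c ] a)) (period f proper (rot a))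
    invariant (ref a) = sym (trans (cong (λ x → f (fromD (ref x))) (sym (//-rightDividesʳ [ c ] a)))
                                   (trans (cong (λ x → f (fromD (ref (x ⊝ [ c ])))) (⊕-comm a [ c ]))
                                          (period f proper (ref ([ c ] ⊕ a)))))

  ρ-nontrivial : ¬ IsIdentity Cay ρ
  ρ-nontrivial fixes = 1+n≢0 ([]-injective (small<N c≤4c) 0<N [c]≡𝟘)
    where
    ρe≡e : rot ([ c ] ⊕ 𝟘) ≡ e
    ρe≡e = fromD-injective (trans (sym (toAut-fromD (translation (rot [ c ])) e)) (fixes (fromD e)))
    [c]≡𝟘 : [ c ] ≡ 𝟘
    [c]≡𝟘 = trans (sym (identityʳ [ c ])) (inj₁-injective ρe≡e)

  ¬distColorable : ¬ DistColorable Cay c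
  ¬distColorable = invariant⇒¬distColorable Cay ρ ρ-nontrivial ρ-invariant

  -- Only the identity fixes e, so a fresh colour for e is distinguishing.
  open Regular (λ S fix → FixingE.identity S fix) public

  distColorable : DistColorable Cay (suc c)
  distColorable = fresh-colour Cay colorable (fromD e) fixes-e⇒identity

  distChromatic : IsDistChromaticNumber Cay (suc c)
  distChromatic = distChromaticNumber Cay chromatic ¬distColorable distColorable

theorem1p1 : (k : ℕ) → 0 < k → (m : ℕ) → Σ Graph λ G → m < size G × Σ ℕ λ c → Σ ℕ λ d → Σ ℕ λ N → IsChromaticNumber G c × IsDistChromaticNumber G d × k < c × c < d × VertexTransitive G × AutOrder G N × N < 2 * k * size G
theorem1p1 (suc j) _ m =
  Cay , m<2N , c , suc c , N + N , chromatic , distChromatic , k<c , n<1+n c , vertexTransitive , autOrder , 2N<2k·2N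
  where
  open Construction j m
  open Colouring j m
  m<2N : m < N + N
  m<2N = ≤-trans (<-≤-trans (m<n+m m {8} z<s) (m≤n*m (8 + m) c)) (m≤m+n N N)
  k<c : suc j < c
  k<c = s≤s (n≤1+n (suc j))
  2N<2k·2N : N + N < 2 * suc j * (N + N)
  2N<2k·2N = <-≤-trans (m<m+n (N + N) z<s) (*-monoˡ-≤ (N + N) (*-monoʳ-≤ 2 {1} {suc j} (s≤s z≤n)))
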